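{- Let $k\ge 2$ be fixed. If a finite group $\Gamma$ contains an abelian subgroup of index $2$, then $$M_k(\Gamma)\le(2^{ -1/k}+o(1))|\Gamma|^{1/k},$$ where $o(1)\to 0$ as $|\Gamma|\to\infty$.
   Context: For a group $\Gamma$, $A\subseteq\Gamma$ is an $S_k$-set if whenever $\alpha_1\cdots\alpha_k=\beta_1\cdots\beta_k$ with all $\alpha_i,\beta_i\in A$, we have $(\alpha_1,\ldots,\alpha_k)=(\beta_1,\ldots,\beta_k)$. $M_k(\Gamma)$ denotes the maximum size of an $S_k$-set in $\Gamma$. -}

module Defs where

open import Level using (0ℓ)
open import Data.Nat using (ℕ; zero; suc)
open import Data.Fin using (Fin; zero; suc)
open import Data.Fin.Subset using (Subset; _∈_; ∣_∣)
open import Data.Product using (_×_)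
open import Relation.Binary.PropositionalEquality using (_≡_)
open import Algebra.Structures using (IsGroup)

-- A finite group of order n, presented on the carrier Fin n with
-- propositional equality (every finite group is isomorphic to one of these).
record FiniteGroup : Set where
  field
    order : ℕ
    _∙_   : Fin order → Fin order → Fin order
    ε     : Fin order
    _⁻¹   : Fin order → Fin order
    isGroup : IsGroup _≡_ _∙_ ε _⁻¹

module _ (G : FiniteGroup) where
  open FiniteGroup G

  prod : ∀ {k} → (Fin k → Fin order) → Fin order
  prod {zero}  α = ε
  prod {suc k} α = α zero ∙ prod (λ i → α (suc i))

  IsSubgroup : Subset order → Set
  IsSubgroup H = (ε ∈ H)
               × (∀ x y → x ∈ H → y ∈ H → (x ∙ y) ∈ H)
               × (∀ x → x ∈ H → (x ⁻¹) ∈ H)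

  IsAbelianIndex2Subgroup : Subset order → Set
  IsAbelianIndex2Subgroup H = IsSubgroup H
                            × (∀ x y → x ∈ H → y ∈ H → (x ∙ y) ≡ (y ∙ x))
                            × (2 Data.Nat.* ∣ H ∣ ≡ order)

  HasAbelianSubgroupOfIndex2 : Set
  HasAbelianSubgroupOfIndex2 = Data.Product.Σ (Subset order) IsAbelianIndex2Subgroup

  IsSkSet : ℕ → Subset order → Set
  IsSkSet k A = (α β : Fin k → Fin order)
              → (∀ i → α i ∈ A) → (∀ i → β i ∈ A)
              → prod α ≡ prod β → ∀ i → α i ≡ β i

{-# OPTIONS --safe #-}
-- At most one element of A lies in the abelian subgroup H: commuting x, y ∈ A give
-- x y x⋯x = y x x⋯x, so x = y. The a ≥ ∣A∣ − 1 elements of A outside H yield a^k distinct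
-- k-fold products; as H has index 2, they all lie in one coset of H. Right multiplication by
-- one s ∈ A ∖ H carries them injectively into the other coset, so 2 a^k ≤ ∣Γ∣. With
-- Q = q^k < 2 P = 2 p^k this gives Q ∣A∣^k ≤ Q (a + 1)^k ≤ (Q + 1) a^k ≤ P ∣Γ∣ as soon as
-- a > Q (2^k − 1), since (1 + 1/a)^k ≤ 1 + (2^k − 1)/a by convexity; the finitely many
-- smaller a are absorbed by taking ∣Γ∣ large.
module Submission where

open import Level using (0ℓ)
open import Defs
open import Algebra.Bundles using (Group)
open import Algebra.Structures using (IsGroup)
import Algebra.Properties.Group as GroupProperties
open import Data.Empty using (⊥-elim)
open import Data.Fin using (Fin; zero; suc; splitAt; join; punchIn; finToFun; funToFin; combine)
open import Data.Fin.Properties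
  using (_≟_; injective⇒≤; punchOut-injective; join-splitAt; punchIn-injective; punchInᵢ≢i; any?;
         funToFin-finToFin; suc-injective)
open import Data.Fin.Subset using (Subset; _∈_; _∉_; ∣_∣; inside; outside)
open import Data.Fin.Subset.Properties using (_∈?_)
open import Data.Nat using (ℕ; zero; suc; _+_; _*_; _^_; _≤_; _<_; z≤n; s≤s; _≤?_)
open import Data.Nat.Properties
  using (≤-refl; ≤-reflexive; ≤-trans; n≤1+n; <⇒≤; <⇒≱; ≰⇒>; +-identityʳ; *-assoc; m≤n*m;
         +-monoʳ-≤; *-monoˡ-≤; *-monoʳ-≤; *-cancelˡ-≤; ^-monoˡ-≤; module ≤-Reasoning)
open import Data.Nat.Tactic.RingSolver using (solve-∀)
open import Data.Product using (Σ; ∃; _×_; _,_; proj₁; proj₂)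
open import Data.Sum using (_⊎_; inj₁; inj₂; [_,_]′)
open import Data.Vec.Base using (_∷_; here; there)
open import Data.Vec.Functional using (_++_)
open import Function using (_∘_; id; const)
open import Function.Definitions using (Injective)
open import Relation.Nullary using (¬_; yes; no)
open import Relation.Nullary.Decidable using (decidable-stable)
open import Relation.Unary using (Pred; Decidable)
open import Relation.Binary.PropositionalEquality

mersenne : ℕ → ℕ
mersenne zero    = zero
mersenne (suc k) = suc (2 * mersenne k)

x*[y*z]≡y*[x*z] : ∀ x y z → x * (y * z) ≡ y * (x * z)
x*[y*z]≡y*[x*z] = solve-∀

n*[1+n]^k≤n^k*[n+mersenne[k]] : ∀ n k → n * suc n ^ k ≤ n ^ k * (n + mersenne k)
n*[1+n]^k≤n^k*[n+mersenne[k]] n         zero    = ≤-reflexive (n*1≡1*[n+0] n)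
  where
  n*1≡1*[n+0] : ∀ n → n * 1 ≡ 1 * (n + 0)
  n*1≡1*[n+0] = solve-∀
n*[1+n]^k≤n^k*[n+mersenne[k]] zero      (suc k) = z≤n
n*[1+n]^k≤n^k*[n+mersenne[k]] n@(suc _) (suc k) = begin
  n * (suc n * suc n ^ k)          ≡⟨ x*[y*z]≡y*[x*z] n (suc n) (suc n ^ k) ⟩
  suc n * (n * suc n ^ k)          ≤⟨ *-monoʳ-≤ (suc n) (n*[1+n]^k≤n^k*[n+mersenne[k]] n k) ⟩
  suc n * (n ^ k * (n + c))        ≡⟨ x*[y*z]≡y*[x*z] (suc n) (n ^ k) (n + c) ⟩
  n ^ k * (suc n * (n + c))        ≤⟨ *-monoʳ-≤ (n ^ k) step ⟩
  n ^ k * (n * (n + suc (2 * c)))  ≡⟨ x*[y*z]≡y*[x*z] (n ^ k) n _ ⟩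
  n * (n ^ k * (n + suc (2 * c)))  ≡⟨ *-assoc n (n ^ k) _ ⟨
  n * n ^ k * (n + suc (2 * c))    ∎
  where
  open ≤-Reasoning
  c : ℕ
  c = mersenne k
  lhs≡ : ∀ x y → suc x * (x + y) ≡ (x * x + x + x * y) + y
  lhs≡ = solve-∀
  rhs≡ : ∀ x y → x * (x + suc (2 * y)) ≡ (x * x + x + x * y) + x * y
  rhs≡ = solve-∀
  step : suc n * (n + c) ≤ n * (n + suc (2 * c))
  step = subst₂ _≤_ (sym (lhs≡ n c)) (sym (rhs≡ n c)) (+-monoʳ-≤ _ (m≤n*m c n))

Q*[1+n]^k≤[1+Q]*n^k : ∀ Q n k → Q * mersenne k < n → Q * suc n ^ k ≤ suc Q * n ^ k
Q*[1+n]^k≤[1+Q]*n^k Q n@(suc _) k Qc<n = *-cancelˡ-≤ n (begin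
  n * (Q * suc n ^ k)              ≡⟨ x*[y*z]≡y*[x*z] n Q (suc n ^ k) ⟩
  Q * (n * suc n ^ k)              ≤⟨ *-monoʳ-≤ Q (n*[1+n]^k≤n^k*[n+mersenne[k]] n k) ⟩
  Q * (n ^ k * (n + mersenne k))   ≡⟨ distribute Q (n ^ k) n (mersenne k) ⟩
  n ^ k * (Q * n + Q * mersenne k) ≤⟨ *-monoʳ-≤ (n ^ k) (+-monoʳ-≤ (Q * n) (<⇒≤ Qc<n)) ⟩
  n ^ k * (Q * n + n)              ≡⟨ collect Q (n ^ k) n ⟩
  n * (suc Q * n ^ k)              ∎)
  where
  open ≤-Reasoning
  distribute : ∀ x y z w → x * (y * (z + w)) ≡ y * (x * z + x * w)
  distribute = solve-∀
  collect : ∀ x y z → y * (x * z + z) ≡ z * (suc x * y)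
  collect = solve-∀

eventually-Q*[1+a]^k≤P*n : ∀ k P Q → Q < 2 * P →
  ∃ λ N → ∀ n a → N ≤ n → 2 * a ^ k ≤ n → Q * suc a ^ k ≤ P * n
eventually-Q*[1+a]^k≤P*n k zero      Q ()
eventually-Q*[1+a]^k≤P*n k P@(suc _) Q Q<2P = Q * suc T ^ k , bound
  where
  T : ℕ
  T = Q * mersenne k
  bound : ∀ n a → Q * suc T ^ k ≤ n → 2 * a ^ k ≤ n → Q * suc a ^ k ≤ P * n
  bound n a N≤n 2a^k≤n with a ≤? T
  ... | yes a≤T = begin
    Q * suc a ^ k  ≤⟨ *-monoʳ-≤ Q (^-monoˡ-≤ k (s≤s a≤T)) ⟩
    Q * suc T ^ k  ≤⟨ N≤n ⟩
    n              ≤⟨ m≤n*m n P ⟩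
    P * n          ∎
    where open ≤-Reasoning
  ... | no a≰T = begin
    Q * suc a ^ k      ≤⟨ Q*[1+n]^k≤[1+Q]*n^k Q a k (≰⇒> a≰T) ⟩
    suc Q * a ^ k      ≤⟨ *-monoˡ-≤ (a ^ k) Q<2P ⟩
    2 * P * a ^ k      ≡⟨ *-assoc 2 P (a ^ k) ⟩
    2 * (P * a ^ k)    ≡⟨ x*[y*z]≡y*[x*z] 2 P (a ^ k) ⟩
    P * (2 * a ^ k)    ≤⟨ *-monoʳ-≤ P 2a^k≤n ⟩
    P * n              ∎
    where open ≤-Reasoning

members : ∀ {n} (p : Subset n) → Fin ∣ p ∣ → Fin n
members (inside  ∷ p) zero    = zero
members (inside  ∷ p) (suc i) = suc (members p i)
members (outside ∷ p) i       = suc (members p i)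

members-∈ : ∀ {n} (p : Subset n) i → members p i ∈ p
members-∈ (inside  ∷ p) zero    = here
members-∈ (inside  ∷ p) (suc i) = there (members-∈ p i)
members-∈ (outside ∷ p) i       = there (members-∈ p i)

members-injective : ∀ {n} (p : Subset n) → Injective _≡_ _≡_ (members p)
members-injective (inside  ∷ p) {zero}  {zero}  _  = refl
members-injective (inside  ∷ p) {suc i} {suc j} eq = cong suc (members-injective p (suc-injective eq))
members-injective (outside ∷ p)                 eq = members-injective p (suc-injective eq)

++-injective : ∀ {a b} {B : Set} {f : Fin a → B} {g : Fin b → B} →
  Injective _≡_ _≡_ f → Injective _≡_ _≡_ g → (∀ i j → f i ≢ g j) → Injective _≡_ _≡_ (f ++ g)
++-injective {a} {b} {f = f} {g} f-inj g-inj f≢g = splitAt-injective ∘ [f,g]-injective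
  where
  [f,g]-injective : Injective _≡_ _≡_ [ f , g ]′
  [f,g]-injective {inj₁ i} {inj₁ j} eq = cong inj₁ (f-inj eq)
  [f,g]-injective {inj₁ i} {inj₂ j} eq = ⊥-elim (f≢g i j eq)
  [f,g]-injective {inj₂ i} {inj₁ j} eq = ⊥-elim (f≢g j i (sym eq))
  [f,g]-injective {inj₂ i} {inj₂ j} eq = cong inj₂ (g-inj eq)
  splitAt-injective : Injective _≡_ _≡_ (splitAt a {b})
  splitAt-injective {i} {j} eq = begin
    i                      ≡⟨ join-splitAt a b i ⟨
    join a b (splitAt a i) ≡⟨ cong (join a b) eq ⟩
    join a b (splitAt a j) ≡⟨ join-splitAt a b j ⟩
    j                      ∎
    where open ≡-Reasoning

funToFin-cong : ∀ {m n} {f g : Fin m → Fin n} → f ≗ g → funToFin f ≡ funToFin g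
funToFin-cong {zero}  f≗g = refl
funToFin-cong {suc m} f≗g = cong₂ combine (f≗g zero) (funToFin-cong (f≗g ∘ suc))

finToFun-injective : ∀ {m n} {x y : Fin (n ^ m)} → finToFun {n} {m} x ≗ finToFun y → x ≡ y
finToFun-injective {m} {n} {x} {y} eq = begin
  x                             ≡⟨ funToFin-finToFin {m} {n} x ⟨
  funToFin (finToFun {n} {m} x) ≡⟨ funToFin-cong eq ⟩
  funToFin (finToFun {n} {m} y) ≡⟨ funToFin-finToFin {m} {n} y ⟩
  y                             ∎
  where open ≡-Reasoning

avoid-subsingleton : ∀ {m} {P : Pred (Fin m) 0ℓ} → Decidable P → (∀ {i j} → P i → P j → i ≡ j) →
  ∃ λ a → m ≤ suc a × Σ (Fin a → Fin m) λ σ → Injective _≡_ _≡_ σ × (∀ j → ¬ P (σ j))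
avoid-subsingleton {m} P? unique with any? P?
... | no ∄P = m , n≤1+n m , id , id , λ j Pj → ∄P (j , Pj)
avoid-subsingleton {suc a} P? unique | yes (i , Pi) =
  a , ≤-refl , punchIn i , punchIn-injective i _ _ , λ j Pj → punchInᵢ≢i i j (unique Pj Pi)

injective⇒surjective : ∀ {m n} {f : Fin m → Fin n} → n ≤ m → Injective _≡_ _≡_ f → ∀ y → ∃ λ i → f i ≡ y
injective⇒surjective {n = suc _} {f} n≤m f-inj y = decidable-stable (any? λ i → f i ≟ y) λ ∄i →
  let y≢f : ∀ i → y ≢ f i
      y≢f i y≡fi = ∄i (i , sym y≡fi)
  in <⇒≱ (s≤s (injective⇒≤ (f-inj ∘ punchOut-injective (y≢f _) (y≢f _)))) n≤m

module _ (G : FiniteGroup) where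
  open FiniteGroup G
  open IsGroup isGroup using (assoc)

  private
    group : Group 0ℓ 0ℓ
    group = record { isGroup = isGroup }

  open GroupProperties group using (∙-cancelˡ; ∙-cancelʳ; ⁻¹-involutive; \\-leftDividesʳ; //-rightDividesʳ)

  Sk-set-commuting⇒≡ : ∀ k {A x y} → IsSkSet G (2 + k) A → x ∈ A → y ∈ A → (x ∙ y) ≡ (y ∙ x) → x ≡ y
  Sk-set-commuting⇒≡ k {A} {x} {y} A-Sk x∈A y∈A xy≡yx = A-Sk xyx… yxx… xyx…∈A yxx…∈A swap zero
    where
    xyx… yxx… : Fin (2 + k) → Fin order
    xyx… zero          = x
    xyx… (suc zero)    = y
    xyx… (suc (suc _)) = x
    yxx… zero          = y
    yxx… (suc zero)    = x
    yxx… (suc (suc _)) = x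
    xyx…∈A : ∀ i → xyx… i ∈ A
    xyx…∈A zero          = x∈A
    xyx…∈A (suc zero)    = y∈A
    xyx…∈A (suc (suc _)) = x∈A
    yxx…∈A : ∀ i → yxx… i ∈ A
    yxx…∈A zero          = y∈A
    yxx…∈A (suc zero)    = x∈A
    yxx…∈A (suc (suc _)) = x∈A
    rest : Fin order
    rest = prod G {k} (const x)
    swap : (x ∙ (y ∙ rest)) ≡ (y ∙ (x ∙ rest))
    swap = begin
      x ∙ (y ∙ rest)   ≡⟨ assoc x y rest ⟨
      (x ∙ y) ∙ rest   ≡⟨ cong (_∙ rest) xy≡yx ⟩
      (y ∙ x) ∙ rest   ≡⟨ assoc y x rest ⟩
      y ∙ (x ∙ rest)   ∎
      where open ≡-Reasoning

  Sk-set-products-injective : ∀ {k a A} → IsSkSet G k A → (e : Fin a → Fin order) →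
    Injective _≡_ _≡_ e → (∀ i → e i ∈ A) → Injective _≡_ _≡_ (λ t → prod G (e ∘ finToFun {a} {k} t))
  Sk-set-products-injective A-Sk e e-inj e∈A eq =
    finToFun-injective (λ i → e-inj (A-Sk _ _ (e∈A ∘ _) (e∈A ∘ _) eq i))

  module Subgroup (H : Subset order) (H≤G : IsSubgroup G H) where
    ∙-closed : ∀ x y → x ∈ H → y ∈ H → (x ∙ y) ∈ H
    ∙-closed = proj₁ (proj₂ H≤G)

    ⁻¹-closed : ∀ x → x ∈ H → (x ⁻¹) ∈ H
    ⁻¹-closed = proj₂ (proj₂ H≤G)

    ∉⇒⁻¹∉ : ∀ {x} → x ∉ H → (x ⁻¹) ∉ H
    ∉⇒⁻¹∉ {x} x∉H x⁻¹∈H = x∉H (subst (_∈ H) (⁻¹-involutive x) (⁻¹-closed _ x⁻¹∈H))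

    ∈∙∉⇒∉ : ∀ {x y} → x ∈ H → y ∉ H → (x ∙ y) ∉ H
    ∈∙∉⇒∉ {x} {y} x∈H y∉H xy∈H =
      y∉H (subst (_∈ H) (\\-leftDividesʳ x y) (∙-closed _ _ (⁻¹-closed x x∈H) xy∈H))

    ∉∙∈⇒∉ : ∀ {x y} → x ∉ H → y ∈ H → (x ∙ y) ∉ H
    ∉∙∈⇒∉ {x} {y} x∉H y∈H xy∈H =
      x∉H (subst (_∈ H) (//-rightDividesʳ y x) (∙-closed _ _ xy∈H (⁻¹-closed y y∈H)))

    module Index2 (∣G∣≡2∣H∣ : 2 * ∣ H ∣ ≡ order) where
      h : ℕ
      h = ∣ H ∣

      ∣G∣≡h+h : order ≡ h + h
      ∣G∣≡h+h = trans (sym ∣G∣≡2∣H∣) (cong (h +_) (+-identityʳ h))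

      H++xH : Fin order → Fin (h + h) → Fin order
      H++xH x = members H ++ ((x ∙_) ∘ members H)

      H++xH-injective : ∀ {x} → x ∉ H → Injective _≡_ _≡_ (H++xH x)
      H++xH-injective {x} x∉H = ++-injective (members-injective H)
        (members-injective H ∘ ∙-cancelˡ x _ _)
        (λ i j m≡xm → ∉∙∈⇒∉ x∉H (members-∈ H j) (subst (_∈ H) m≡xm (members-∈ H i)))

      coset-cover : ∀ {x} → x ∉ H → ∀ y → y ∈ H ⊎ ((x ⁻¹) ∙ y) ∈ H
      coset-cover {x} x∉H y with injective⇒surjective (≤-reflexive ∣G∣≡h+h) (H++xH-injective x∉H) y
      ... | j , eq with splitAt h j
      ... | inj₁ i = inj₁ (subst (_∈ H) eq (members-∈ H i))
      ... | inj₂ i = inj₂ (subst (λ z → ((x ⁻¹) ∙ z) ∈ H) eq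
                             (subst (_∈ H) (sym (\\-leftDividesʳ x _)) (members-∈ H i)))

      ∉∙∉⇒∈ : ∀ {x y} → x ∉ H → y ∉ H → (x ∙ y) ∈ H
      ∉∙∉⇒∈ {x} {y} x∉H y∉H with coset-cover (∉⇒⁻¹∉ x∉H) y
      ... | inj₁ y∈H = ⊥-elim (y∉H y∈H)
      ... | inj₂ x⁻¹⁻¹y∈H = subst (λ z → (z ∙ y) ∈ H) (⁻¹-involutive x) x⁻¹⁻¹y∈H

      prod-outside-∈ : ∀ {k} (α β : Fin k → Fin order) → (∀ i → α i ∉ H) → (∀ i → β i ∉ H) →
        prod G α ∈ H → prod G β ∈ H
      prod-outside-∈ {zero}  α β α∉H β∉H ∏α∈H = ∏α∈H
      prod-outside-∈ {suc k} α β α∉H β∉H ∏α∈H = ∉∙∉⇒∈ (β∉H zero) ∏β′∉H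
        where
        ∏α′∉H : prod G (α ∘ suc) ∉ H
        ∏α′∉H ∏α′∈H = ∉∙∈⇒∉ (α∉H zero) ∏α′∈H ∏α∈H
        ∏β′∉H : prod G (β ∘ suc) ∉ H
        ∏β′∉H = ∏α′∉H ∘ prod-outside-∈ (β ∘ suc) (α ∘ suc) (β∉H ∘ suc) (α∉H ∘ suc)

      -- Right multiplication by s ∉ H moves the image of f to the other coset.
      one-coset-injection⇒2*≤∣G∣ : ∀ {X s} (f : Fin X → Fin order) → Injective _≡_ _≡_ f →
        (∀ i j → f i ∈ H → f j ∈ H) → s ∉ H → 2 * X ≤ order
      one-coset-injection⇒2*≤∣G∣ {X} {s} f f-inj one-coset s∉H = subst (_≤ order) X+X≡2*X
        (injective⇒≤ (++-injective f-inj (f-inj ∘ ∙-cancelʳ s _ _) f≢fs))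
        where
        X+X≡2*X : X + X ≡ 2 * X
        X+X≡2*X = cong (X +_) (sym (+-identityʳ X))
        f≢fs : ∀ i j → f i ≢ (f j ∙ s)
        f≢fs i j fi≡fjs with f j ∈? H
        ... | yes fj∈H = ∈∙∉⇒∉ fj∈H s∉H (subst (_∈ H) fi≡fjs (one-coset j i fj∈H))
        ... | no  fj∉H = fj∉H (one-coset i j (subst (_∈ H) (sym fi≡fjs) (∉∙∉⇒∈ fj∉H s∉H)))

      outside-Sk-set-bound : ∀ {k a A} → IsSkSet G (suc k) A → (e : Fin a → Fin order) →
        Injective _≡_ _≡_ e → (∀ i → e i ∈ A) → (∀ i → e i ∉ H) → 2 * a ^ suc k ≤ order
      outside-Sk-set-bound {a = zero}  _    _ _     _   _   = z≤n
      outside-Sk-set-bound {k} {suc a} A-Sk e e-inj e∈A e∉H = one-coset-injection⇒2*≤∣G∣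
        (λ t → prod G (tuple t)) (Sk-set-products-injective A-Sk e e-inj e∈A)
        (λ t u → prod-outside-∈ (tuple t) (tuple u) (e∉H ∘ _) (e∉H ∘ _)) (e∉H zero)
        where
        tuple : Fin (suc a ^ suc k) → Fin (suc k) → Fin order
        tuple t = e ∘ finToFun t

      Sk-set-bound : ∀ k {A} → IsSkSet G (2 + k) A → (∀ x y → x ∈ H → y ∈ H → (x ∙ y) ≡ (y ∙ x)) →
        ∃ λ a → ∣ A ∣ ≤ suc a × 2 * a ^ (2 + k) ≤ order
      Sk-set-bound k {A} A-Sk H-comm =
        let a , ∣A∣≤1+a , σ , σ-inj , σ∉H = avoid-subsingleton (λ i → members A i ∈? H) unique
        in a , ∣A∣≤1+a , outside-Sk-set-bound A-Sk (members A ∘ σ)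
             (σ-inj ∘ members-injective A) (members-∈ A ∘ σ) σ∉H
        where
        unique : ∀ {i j} → members A i ∈ H → members A j ∈ H → i ≡ j
        unique {i} {j} i∈H j∈H = members-injective A (Sk-set-commuting⇒≡ k A-Sk
          (members-∈ A i) (members-∈ A j) (H-comm _ _ i∈H j∈H))

proposition6p1 : (k : ℕ) → 2 ≤ k → (p q : ℕ) → 1 ≤ q → q ^ k < 2 * p ^ k →
    Σ ℕ (λ N → (G : FiniteGroup) → N ≤ FiniteGroup.order G →
      HasAbelianSubgroupOfIndex2 G → (A : Subset (FiniteGroup.order G)) →
      IsSkSet G k A →
      q ^ k * ∣ A ∣ ^ k ≤ p ^ k * FiniteGroup.order G)
proposition6p1 zero             ()
proposition6p1 (suc zero)       (s≤s ())
proposition6p1 k@(suc (suc k′)) _ p q _ q^k<2p^k =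
  let N , large⇒bound = eventually-Q*[1+a]^k≤P*n k (p ^ k) (q ^ k) q^k<2p^k
  in N , λ G N≤∣G∣ (H , H≤G , H-comm , ∣G∣≡2∣H∣) A A-Sk →
    let a , ∣A∣≤1+a , 2*a^k≤∣G∣ = Subgroup.Index2.Sk-set-bound G H H≤G ∣G∣≡2∣H∣ k′ A-Sk H-comm
    in ≤-trans (*-monoʳ-≤ (q ^ k) (^-monoˡ-≤ k ∣A∣≤1+a)) (large⇒bound _ a N≤∣G∣ 2*a^k≤∣G∣)
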